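{- For every integer $q\ge 2$, the graph $KE_q$ is $2K_2$-free, has chromatic number $2q$, and admits a frozen $3q$-colouring.
   Context: For $q\ge 1$, $\overline{KE_q}$ is the graph with the $6q$ vertices $v_{i1},v_{i2},v_{i3}$ ($i=1,\dots,2q$), whose edges are: the edges of the Hamiltonian cycle $v_{11},v_{12},v_{13},v_{21},v_{22},v_{23},\dots,v_{2q\,1},v_{2q\,2},v_{2q\,3},v_{11}$; the edges $v_{i1}v_{i3}$ for $i=1,\dots,2q$; and the edges $v_{i2}v_{i+q\,2}$ for $i=1,\dots,q$. $KE_q$ is the complement of $\overline{KE_q}$. A $k$-colouring is a partition of the vertex set into at most $k$ (ordered, possibly empty) independent sets (colour classes); it is frozen if every vertex $v$ has a neighbour in each of the $k$ colour classes other than its own. $2K_2$ is the disjoint union of two edges; a graph is $2K_2$-free if it has no induced $2K_2$. -}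

module Defs where

import Data.Nat as ℕ
open import Data.Nat using (ℕ; _+_; _*_; _<_; NonZero)
open import Data.Fin using (Fin; toℕ; zero; suc)
open import Data.Empty using (⊥)
open import Data.Sum using (_⊎_)
open import Data.Product using (_×_; Σ; ∃; _,_)
open import Relation.Nullary using (¬_)
open import Relation.Binary.PropositionalEquality using (_≡_; _≢_)

record Graph : Set₁ where
  field
    V   : Set
    Adj : V → V → Set

open Graph public

IsProperColouring : (G : Graph) (k : ℕ) → (V G → Fin k) → Set
IsProperColouring G k c = ∀ u v → Adj G u v → c u ≢ c v

Colourable : Graph → ℕ → Set
Colourable G k = Σ (V G → Fin k) (IsProperColouring G k)

ChromaticNumber : Graph → ℕ → Set
ChromaticNumber G k = Colourable G k × (∀ m → m < k → ¬ Colourable G m)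

IsFrozen : (G : Graph) (k : ℕ) → (V G → Fin k) → Set
IsFrozen G k c = IsProperColouring G k c ×
  (∀ v (a : Fin k) → a ≢ c v → ∃ λ w → Adj G v w × c w ≡ a)

HasFrozenColouring : Graph → ℕ → Set
HasFrozenColouring G k = Σ (V G → Fin k) (IsFrozen G k)

2K₂-free : Graph → Set
2K₂-free G = ∀ a b c d → Adj G a b → Adj G c d →
  ¬ Adj G a c → ¬ Adj G a d → ¬ Adj G b c → ¬ Adj G b d → ⊥

-- Vertices of KE_q: v_{i j} is (i , j) with i ∈ Fin (2q) (0-based, i.e. paper
-- index i+1) and j ∈ Fin 3 (0-based, paper index j+1).
KEVertex : ℕ → Set
KEVertex q = Fin (2 * q) × Fin 3

-- Directed generating edges of the complement graph \overline{KE_q}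
data KEbarEdge (q : ℕ) : KEVertex q → KEVertex q → Set where
  -- Hamiltonian cycle: v_{i1} v_{i2} and v_{i2} v_{i3}
  cyc12 : ∀ i → KEbarEdge q (i , zero) (i , suc zero)
  cyc23 : ∀ i → KEbarEdge q (i , suc zero) (i , suc (suc zero))
  -- Hamiltonian cycle: v_{i3} v_{(i+1) 1} (non-wrapping case)
  cyc31 : ∀ i i' → toℕ i' ≡ ℕ.suc (toℕ i) →
          KEbarEdge q (i , suc (suc zero)) (i' , zero)
  -- Hamiltonian cycle: closing edge v_{2q 3} v_{1 1}
  cyc31-wrap : ∀ i i' → ℕ.suc (toℕ i) ≡ 2 * q → toℕ i' ≡ 0 →
          KEbarEdge q (i , suc (suc zero)) (i' , zero)
  chord13 : ∀ i → KEbarEdge q (i , zero) (i , suc (suc zero))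
  diam : ∀ i i' → toℕ i < q → toℕ i' ≡ toℕ i + q →
         KEbarEdge q (i , suc zero) (i' , suc zero)

KEbarAdj : (q : ℕ) → KEVertex q → KEVertex q → Set
KEbarAdj q u v = KEbarEdge q u v ⊎ KEbarEdge q v u

KEbar : ℕ → Graph
KEbar q = record { V = KEVertex q ; Adj = KEbarAdj q }

KE : ℕ → Graph
KE q = record { V = KEVertex q ; Adj = λ u v → u ≢ v × ¬ KEbarAdj q u v }

{-# OPTIONS --safe #-}
-- \overline{KE_q} is the disjoint union of the 2q triangles {v_{i1}, v_{i2}, v_{i3}} together with
-- a perfect matching between them: the cycle edges v_{i3} v_{i+1,1} and the diameters
-- v_{i2} v_{i+q,2}. Colouring KE_q by triangles uses 2q colours, and the v_{i1} form a clique.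
-- An induced 2K₂ of KE_q is an induced C₄ of \overline{KE_q}; its edges must alternate between
-- triangle and matching edges, so two distinct matching edges would join the same two triangles,
-- which cannot happen for q ≥ 2 because the triangles i + 1, i - 1 and i + q are then distinct.
-- Colouring KE_q by the 3q matching edges is frozen: off its own matching edge, a vertex is
-- adjacent in \overline{KE_q} only to its triangle, which another matching edge meets at most once.
module Submission where

open import Defs
open import Data.Nat using (ℕ; suc; _+_; _*_; _≤_; _<_; z≤n; s≤s; _<?_)
open import Data.Nat.Properties
  using (suc-injective; +-comm; +-identityʳ; +-cancelˡ-≡; +-cancelʳ-≡; *-monoʳ-≤; m≤n+m;
         m≢1+m+n; n≤1+n; n≮0; ≤-trans; ≤-antisym; <-irrefl; <⇒≱; ≮⇒≥; >⇒≢)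
open import Data.Fin using (Fin; suc; toℕ; fromℕ; fromℕ<; inject₁; combine; remQuot; _≟_)
open import Data.Fin.Patterns using (0F; 1F; 2F)
open import Data.Fin.Properties
  using (toℕ-injective; toℕ<n; toℕ-fromℕ; toℕ-fromℕ<; toℕ-inject₁; toℕ-↑ˡ; toℕ-↑ʳ;
         remQuot-combine; combine-remQuot; pigeonhole; +↔⊎; <⇒≢)
open import Data.Product using (_×_; _,_; proj₁; proj₂; ∃; uncurry)
open import Data.Sum using (_⊎_; inj₁; inj₂; [_,_]) renaming (map to map⊎; swap to swap⊎)
open import Data.Empty using (⊥; ⊥-elim)
open import Function using (_∘_; _↔_; Inverse)
open import Relation.Nullary using (¬_; yes; no; contradiction)
open import Relation.Binary.Definitions using (Symmetric; DecidableEquality)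
open import Relation.Binary.PropositionalEquality using (_≡_; _≢_; refl; sym; trans; cong; subst)

Complement : Graph → Graph
Complement G = record { V = V G ; Adj = λ u v → u ≢ v × ¬ Adj G u v }

Induced-C₄-free : Graph → Set
Induced-C₄-free G = ∀ {a b c d} → Adj G a c → Adj G a d → Adj G b c → Adj G b d →
  Adj (Complement G) a b → Adj (Complement G) c d → ⊥

complement-2K₂-free : ∀ {G} → Symmetric (Adj G) → Induced-C₄-free G → 2K₂-free (Complement G)
-- Non-adjacency in the complement only gives ¬ ¬-adjacency in G, which suffices as the goal is ⊥.
complement-2K₂-free {G} sym-adj no-C₄ a b c d ab cd ¬ac ¬ad ¬bc ¬bd =
  adjacent ¬ac a≢c λ ac → adjacent ¬ad a≢d λ ad → adjacent ¬bc b≢c λ bc → adjacent ¬bd b≢d λ bd →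
    no-C₄ ac ad bc bd ab cd
  where
  co-sym : ∀ {u v} → Adj (Complement G) u v → Adj (Complement G) v u
  co-sym (u≢v , ¬uv) = u≢v ∘ sym , ¬uv ∘ sym-adj

  adjacent : ∀ {u v} → ¬ Adj (Complement G) u v → u ≢ v → ¬ ¬ Adj G u v
  adjacent ¬co u≢v ¬uv = ¬co (u≢v , ¬uv)

  a≢c : a ≢ c
  a≢c refl = ¬ad cd
  a≢d : a ≢ d
  a≢d refl = ¬ac (co-sym cd)
  b≢c : b ≢ c
  b≢c refl = ¬bd cd
  b≢d : b ≢ d
  b≢d refl = ¬bc (co-sym cd)

clique⇒¬colourable : ∀ {G n} (f : Fin n → V G) → (∀ {i j} → i ≢ j → Adj G (f i) (f j)) →
  ∀ m → m < n → ¬ Colourable G m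
clique⇒¬colourable f clique _ m<n (c , proper) with pigeonhole m<n (c ∘ f)
... | i , j , i<j , same = proper (f i) (f j) (clique (<⇒≢ i<j)) same

record PerfectMatching {V : Set} (_~_ : V → V → Set) (E : Set) : Set where
  field
    edge      : V → E
    end₁ end₂ : E → V
    end₁~end₂ : ∀ e → end₁ e ~ end₂ e
    edge-end₁ : ∀ e → edge (end₁ e) ≡ e
    edge-end₂ : ∀ e → edge (end₂ e) ≡ e
    end₁⊎end₂ : ∀ u → u ≡ end₁ (edge u) ⊎ u ≡ end₂ (edge u)

reindex : ∀ {V E E′} {_~_ : V → V → Set} → E′ ↔ E → PerfectMatching _~_ E → PerfectMatching _~_ E′
reindex E′↔E M = record
  { edge      = from ∘ edge
  ; end₁      = end₁ ∘ to
  ; end₂      = end₂ ∘ to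
  ; end₁~end₂ = end₁~end₂ ∘ to
  ; edge-end₁ = λ e → trans (cong from (edge-end₁ (to e))) (strictlyInverseʳ e)
  ; edge-end₂ = λ e → trans (cong from (edge-end₂ (to e))) (strictlyInverseʳ e)
  ; end₁⊎end₂ = λ u → subst (λ e → u ≡ end₁ e ⊎ u ≡ end₂ e)
                            (sym (strictlyInverseˡ (edge u))) (end₁⊎end₂ u)
  }
  where open PerfectMatching M
        open Inverse E′↔E

module CliquesPlusMatching
  (G : Graph) {Block : Set} (block : V G → Block)
  (_~_ : V G → V G → Set)
  (~-sym : Symmetric _~_)
  (~-functional : ∀ {u v w} → u ~ v → u ~ w → v ≡ w)
  (~-between-blocks : ∀ {u v} → u ~ v → block u ≢ block v)
  (adj-in-block : ∀ {u v} → block u ≡ block v → u ≢ v → Adj G u v)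
  (~⇒adj : ∀ {u v} → u ~ v → Adj G u v)
  (adj⇒in-block⊎~ : ∀ {u v} → Adj G u v → block u ≡ block v ⊎ u ~ v)
  where

  block-colouring-proper : ∀ {u v} → Adj (Complement G) u v → block u ≢ block v
  block-colouring-proper (u≢v , ¬uv) same = ¬uv (adj-in-block same u≢v)

  module _ (one-edge-between : ∀ {u v u′ v′} → u ~ v → u′ ~ v′ →
                               block u ≡ block u′ → block v ≡ block v′ → u ≡ u′) where

    private
      mixed-C₄ : ∀ {a b c d} → block a ≡ block c → b ~ c → Adj G a d → Adj G b d →
        Adj (Complement G) c d → ⊥
      mixed-C₄ ac-in b~c ad bd (c≢d , ¬cd) with adj⇒in-block⊎~ ad | adj⇒in-block⊎~ bd
      ... | inj₁ ad-in | _         = ¬cd (adj-in-block (trans (sym ac-in) ad-in) c≢d)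
      ... | inj₂ _     | inj₂ b~d  = c≢d (~-functional b~c b~d)
      ... | inj₂ a~d   | inj₁ bd-in with one-edge-between (~-sym b~c) a~d (sym ac-in) bd-in
      ...   | refl = ¬cd ad

    induced-C₄-free : Induced-C₄-free G
    induced-C₄-free ac ad bc bd (a≢b , ¬ab) cd with adj⇒in-block⊎~ ac | adj⇒in-block⊎~ bc
    ... | inj₁ ac-in | inj₁ bc-in = ¬ab (adj-in-block (trans ac-in (sym bc-in)) a≢b)
    ... | inj₂ a~c   | inj₂ b~c   = a≢b (~-functional (~-sym a~c) (~-sym b~c))
    ... | inj₁ ac-in | inj₂ b~c   = mixed-C₄ ac-in b~c ad bd cd
    ... | inj₂ a~c   | inj₁ bc-in = mixed-C₄ bc-in a~c bd ad cd

  module _ {k} (M : PerfectMatching _~_ (Fin k)) where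
    open PerfectMatching M

    _isEndOf_ : V G → Fin k → Set
    u isEndOf e = u ≡ end₁ e ⊎ u ≡ end₂ e

    ends-≡⊎~ : ∀ {u v e} → u isEndOf e → v isEndOf e → u ≡ v ⊎ u ~ v
    ends-≡⊎~ (inj₁ refl) (inj₁ refl) = inj₁ refl
    ends-≡⊎~ (inj₂ refl) (inj₂ refl) = inj₁ refl
    ends-≡⊎~ (inj₁ refl) (inj₂ refl) = inj₂ (end₁~end₂ _)
    ends-≡⊎~ (inj₂ refl) (inj₁ refl) = inj₂ (~-sym (end₁~end₂ _))

    matched-to-end⇒edge : ∀ {u v e} → u ~ v → v isEndOf e → edge u ≡ e
    matched-to-end⇒edge u~v (inj₁ refl) =
      trans (cong edge (~-functional (~-sym u~v) (end₁~end₂ _))) (edge-end₂ _)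
    matched-to-end⇒edge u~v (inj₂ refl) =
      trans (cong edge (~-functional (~-sym u~v) (~-sym (end₁~end₂ _)))) (edge-end₁ _)

    ~⇒same-edge : ∀ {u v} → u ~ v → edge u ≡ edge v
    ~⇒same-edge u~v = matched-to-end⇒edge u~v (end₁⊎end₂ _)

    same-edge⇒≡⊎~ : ∀ {u v} → edge u ≡ edge v → u ≡ v ⊎ u ~ v
    same-edge⇒≡⊎~ {u} same = ends-≡⊎~ (subst (u isEndOf_) same (end₁⊎end₂ u)) (end₁⊎end₂ _)

    co-adjacent : ∀ {v w e} → e ≢ edge v → edge w ≡ e → block v ≢ block w →
      Adj (Complement G) v w
    co-adjacent e≢ refl block≢ =
      e≢ ∘ sym ∘ cong edge , [ block≢ , e≢ ∘ sym ∘ ~⇒same-edge ] ∘ adj⇒in-block⊎~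

    matching-frozen : DecidableEquality Block → IsFrozen (Complement G) k edge
    matching-frozen _≟ᴮ_ = proper , frozen
      where
      proper : IsProperColouring (Complement G) k edge
      proper u v (u≢v , ¬uv) same = [ u≢v , ¬uv ∘ ~⇒adj ] (same-edge⇒≡⊎~ same)

      frozen : ∀ v e → e ≢ edge v → ∃ λ w → Adj (Complement G) v w × edge w ≡ e
      frozen v e e≢ with block v ≟ᴮ block (end₁ e)
      ... | yes same-block =
        end₂ e , co-adjacent e≢ (edge-end₂ e)
                             (~-between-blocks (end₁~end₂ e) ∘ trans (sym same-block))
               , edge-end₂ e
      ... | no different-block = end₁ e , co-adjacent e≢ (edge-end₁ e) different-block , edge-end₁ e

data CycleSucc (n a b : ℕ) : Set where
  step : b ≡ suc a → CycleSucc n a b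
  wrap : suc a ≡ n → b ≡ 0 → CycleSucc n a b

module _ {n : ℕ} where

  cycleSucc-functional : ∀ {a b c} → CycleSucc n a b → CycleSucc n a c → b < n → c < n → b ≡ c
  cycleSucc-functional (step refl) (step refl) _   _   = refl
  cycleSucc-functional (wrap _ refl) (wrap _ refl) _ _ = refl
  cycleSucc-functional (step refl) (wrap refl _) b<n _ = contradiction b<n (<-irrefl refl)
  cycleSucc-functional (wrap refl _) (step refl) _ c<n = contradiction c<n (<-irrefl refl)

  cycleSucc-injective : ∀ {a b c} → CycleSucc n a c → CycleSucc n b c → a ≡ b
  cycleSucc-injective (step refl) (step e)     = suc-injective e
  cycleSucc-injective (wrap e _) (wrap e′ _)   = suc-injective (trans e (sym e′))
  cycleSucc-injective (step refl) (wrap _ ())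
  cycleSucc-injective (wrap _ refl) (step ())

  cycleSucc-irrefl : 1 < n → ∀ {a} → ¬ CycleSucc n a a
  cycleSucc-irrefl (s≤s ()) (wrap refl refl)

  cycleSucc-asym : 2 < n → ∀ {a b} → CycleSucc n a b → ¬ CycleSucc n b a
  cycleSucc-asym (s≤s (s≤s ())) (step refl) (wrap refl refl)
  cycleSucc-asym (s≤s (s≤s ())) (wrap refl refl) (step refl)

next : ∀ {n} → Fin n → Fin n
next {suc m} i with suc (toℕ i) <? suc m
... | yes i+1<n = fromℕ< i+1<n
... | no  _     = 0F

next-spec : ∀ {n} (i : Fin n) → CycleSucc n (toℕ i) (toℕ (next i))
next-spec {suc m} i with suc (toℕ i) <? suc m
... | yes i+1<n = step (toℕ-fromℕ< i+1<n)
... | no  i+1≮n = wrap (≤-antisym (toℕ<n i) (≮⇒≥ i+1≮n)) refl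

prev : ∀ {n} → Fin n → Fin n
prev {suc m} 0F      = fromℕ m
prev         (suc i) = inject₁ i

prev-spec : ∀ {n} (i : Fin n) → CycleSucc n (toℕ (prev i)) (toℕ i)
prev-spec {suc m} 0F      = wrap (cong suc (toℕ-fromℕ m)) refl
prev-spec         (suc i) = step (cong suc (sym (toℕ-inject₁ i)))

prev-next : ∀ {n} (i : Fin n) → prev (next i) ≡ i
prev-next i = toℕ-injective (cycleSucc-injective (prev-spec (next i)) (next-spec i))

next-prev : ∀ {n} (i : Fin n) → next (prev i) ≡ i
next-prev i = toℕ-injective
  (cycleSucc-functional (next-spec (prev i)) (prev-spec i) (toℕ<n _) (toℕ<n i))

data Antipodal (q a b : ℕ) : Set where
  up   : a < q → b ≡ a + q → Antipodal q a b
  down : b < q → a ≡ b + q → Antipodal q a b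

module _ {q : ℕ} where

  antipodal-sym : ∀ {a b} → Antipodal q a b → Antipodal q b a
  antipodal-sym (up a<q b≡a+q)   = down a<q b≡a+q
  antipodal-sym (down b<q a≡b+q) = up b<q a≡b+q

  antipodal-functional : ∀ {a b c} → Antipodal q a b → Antipodal q a c → b ≡ c
  antipodal-functional (up _ refl)   (up _ refl)   = refl
  antipodal-functional (down _ refl) (down _ e)    = +-cancelʳ-≡ q _ _ e
  antipodal-functional (up a<q _)    (down _ refl) = ⊥-elim (<⇒≱ a<q (m≤n+m q _))
  antipodal-functional (down _ refl) (up a<q _)    = ⊥-elim (<⇒≱ a<q (m≤n+m q _))

  antipodal-irrefl : ∀ {a} → ¬ Antipodal q a a
  antipodal-irrefl (up a<q a≡a+q)   = <⇒≱ a<q (subst (q ≤_) (sym a≡a+q) (m≤n+m q _))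
  antipodal-irrefl (down a<q a≡a+q) = <⇒≱ a<q (subst (q ≤_) (sym a≡a+q) (m≤n+m q _))

  cycleSucc-not-antipodal : q ≢ 1 → ∀ {a b} → CycleSucc (2 * q) a b → ¬ Antipodal q a b
  cycleSucc-not-antipodal q≢1 (step refl) (up _ 1+a≡a+q) =
    q≢1 (sym (+-cancelˡ-≡ _ 1 q (trans (+-comm _ 1) 1+a≡a+q)))
  cycleSucc-not-antipodal _ (step refl) (down _ a≡1+a+q) = m≢1+m+n _ a≡1+a+q
  cycleSucc-not-antipodal _ (wrap _ refl) (up a<q 0≡a+q) =
    n≮0 (≤-trans a<q (subst (q ≤_) (sym 0≡a+q) (m≤n+m q _)))
  cycleSucc-not-antipodal q≢1 (wrap 1+q≡2q refl) (down _ refl) =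
    q≢1 (sym (+-cancelˡ-≡ q 1 q q+1≡q+q))
    where
    q+1≡q+q : q + 1 ≡ q + q
    q+1≡q+q = trans (+-comm q 1) (trans 1+q≡2q (cong (q +_) (+-identityʳ q)))

  lower upper : Fin q → Fin (2 * q)
  lower = combine {2} 0F
  upper = combine {2} 1F

  residue : Fin (2 * q) → Fin q
  residue i = proj₂ (remQuot {2} q i)

  toℕ-lower : ∀ r → toℕ (lower r) ≡ toℕ r
  toℕ-lower r = toℕ-↑ˡ r (1 * q)

  toℕ-upper : ∀ r → toℕ (upper r) ≡ toℕ r + q
  toℕ-upper r = trans (toℕ-↑ʳ q _) (trans (cong (q +_) (toℕ-↑ˡ r (0 * q))) (+-comm q _))

  lower-upper-antipodal : ∀ r → Antipodal q (toℕ (lower r)) (toℕ (upper r))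
  lower-upper-antipodal r =
    up (subst (_< q) (sym (toℕ-lower r)) (toℕ<n r))
       (trans (toℕ-upper r) (cong (_+ q) (sym (toℕ-lower r))))

  residue-lower : ∀ r → residue (lower r) ≡ r
  residue-lower r = cong proj₂ (remQuot-combine {2} 0F r)

  residue-upper : ∀ r → residue (upper r) ≡ r
  residue-upper r = cong proj₂ (remQuot-combine {2} 1F r)

  lower⊎upper : ∀ i → i ≡ lower (residue i) ⊎ i ≡ upper (residue i)
  lower⊎upper i = from-quotient (remQuot {2} q i) (combine-remQuot {2} q i)
    where
    from-quotient : ∀ p → uncurry combine p ≡ i → i ≡ lower (proj₂ p) ⊎ i ≡ upper (proj₂ p)
    from-quotient (0F , _) p≡i = inj₁ (sym p≡i)
    from-quotient (1F , _) p≡i = inj₂ (sym p≡i)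

-- The edges of \overline{KE_q} that leave a triangle.
data Matched (q : ℕ) : KEVertex q → KEVertex q → Set where
  forward  : ∀ {i j} → CycleSucc (2 * q) (toℕ i) (toℕ j) → Matched q (i , 2F) (j , 0F)
  backward : ∀ {i j} → CycleSucc (2 * q) (toℕ j) (toℕ i) → Matched q (i , 0F) (j , 2F)
  across   : ∀ {i j} → Antipodal q (toℕ i) (toℕ j)       → Matched q (i , 1F) (j , 1F)

module _ {q : ℕ} where

  2<2*q : 2 ≤ q → 2 < 2 * q
  2<2*q 2≤q = ≤-trans (n≤1+n 3) (*-monoʳ-≤ 2 2≤q)

  matched-sym : Symmetric (Matched q)
  matched-sym (forward s)  = backward s
  matched-sym (backward s) = forward s
  matched-sym (across a)   = across (antipodal-sym a)

  matched-functional : ∀ {u v w} → Matched q u v → Matched q u w → v ≡ w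
  matched-functional (forward s) (forward s′) =
    cong (_, 0F) (toℕ-injective (cycleSucc-functional s s′ (toℕ<n _) (toℕ<n _)))
  matched-functional (backward s) (backward s′) =
    cong (_, 2F) (toℕ-injective (cycleSucc-injective s s′))
  matched-functional (across a) (across a′) =
    cong (_, 1F) (toℕ-injective (antipodal-functional a a′))

  matched-between-triangles : 0 < q → ∀ {u v} → Matched q u v → proj₁ u ≢ proj₁ v
  matched-between-triangles 0<q (forward s)  refl = cycleSucc-irrefl (*-monoʳ-≤ 2 0<q) s
  matched-between-triangles 0<q (backward s) refl = cycleSucc-irrefl (*-monoʳ-≤ 2 0<q) s
  matched-between-triangles _   (across a)   refl = antipodal-irrefl a

  matched-unique-between-triangles : 2 ≤ q → ∀ {u v u′ v′} → Matched q u v → Matched q u′ v′ →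
    proj₁ u ≡ proj₁ u′ → proj₁ v ≡ proj₁ v′ → u ≡ u′
  matched-unique-between-triangles _ (forward _)  (forward _)  refl refl = refl
  matched-unique-between-triangles _ (backward _) (backward _) refl refl = refl
  matched-unique-between-triangles _ (across _)   (across _)   refl refl = refl
  matched-unique-between-triangles 2≤q (forward s) (backward s′) refl refl =
    ⊥-elim (cycleSucc-asym (2<2*q 2≤q) s s′)
  matched-unique-between-triangles 2≤q (backward s) (forward s′) refl refl =
    ⊥-elim (cycleSucc-asym (2<2*q 2≤q) s s′)
  matched-unique-between-triangles 2≤q (forward s) (across a) refl refl =
    ⊥-elim (cycleSucc-not-antipodal (>⇒≢ 2≤q) s a)
  matched-unique-between-triangles 2≤q (across a) (forward s) refl refl =
    ⊥-elim (cycleSucc-not-antipodal (>⇒≢ 2≤q) s a)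
  matched-unique-between-triangles 2≤q (backward s) (across a) refl refl =
    ⊥-elim (cycleSucc-not-antipodal (>⇒≢ 2≤q) s (antipodal-sym a))
  matched-unique-between-triangles 2≤q (across a) (backward s) refl refl =
    ⊥-elim (cycleSucc-not-antipodal (>⇒≢ 2≤q) s (antipodal-sym a))

  KEbarAdj-sym : Symmetric (KEbarAdj q)
  KEbarAdj-sym = swap⊎

  KEbarAdj-in-triangle : ∀ {u v} → proj₁ u ≡ proj₁ v → u ≢ v → KEbarAdj q u v
  KEbarAdj-in-triangle {i , 0F} {_ , 0F} refl u≢v = contradiction refl u≢v
  KEbarAdj-in-triangle {i , 0F} {_ , 1F} refl _   = inj₁ (cyc12 i)
  KEbarAdj-in-triangle {i , 0F} {_ , 2F} refl _   = inj₁ (chord13 i)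
  KEbarAdj-in-triangle {i , 1F} {_ , 0F} refl _   = inj₂ (cyc12 i)
  KEbarAdj-in-triangle {i , 1F} {_ , 1F} refl u≢v = contradiction refl u≢v
  KEbarAdj-in-triangle {i , 1F} {_ , 2F} refl _   = inj₁ (cyc23 i)
  KEbarAdj-in-triangle {i , 2F} {_ , 0F} refl _   = inj₂ (chord13 i)
  KEbarAdj-in-triangle {i , 2F} {_ , 1F} refl _   = inj₂ (cyc23 i)
  KEbarAdj-in-triangle {i , 2F} {_ , 2F} refl u≢v = contradiction refl u≢v

  matched⇒KEbarAdj : ∀ {u v} → Matched q u v → KEbarAdj q u v
  matched⇒KEbarAdj (forward  (step e))     = inj₁ (cyc31 _ _ e)
  matched⇒KEbarAdj (forward  (wrap e e₀))  = inj₁ (cyc31-wrap _ _ e e₀)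
  matched⇒KEbarAdj (backward (step e))     = inj₂ (cyc31 _ _ e)
  matched⇒KEbarAdj (backward (wrap e e₀))  = inj₂ (cyc31-wrap _ _ e e₀)
  matched⇒KEbarAdj (across (up i<q e))     = inj₁ (diam _ _ i<q e)
  matched⇒KEbarAdj (across (down j<q e))   = inj₂ (diam _ _ j<q e)

  KEbarEdge⇒in-triangle⊎matched : ∀ {u v} → KEbarEdge q u v → proj₁ u ≡ proj₁ v ⊎ Matched q u v
  KEbarEdge⇒in-triangle⊎matched (cyc12 _)             = inj₁ refl
  KEbarEdge⇒in-triangle⊎matched (cyc23 _)             = inj₁ refl
  KEbarEdge⇒in-triangle⊎matched (chord13 _)           = inj₁ refl
  KEbarEdge⇒in-triangle⊎matched (cyc31 _ _ e)         = inj₂ (forward (step e))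
  KEbarEdge⇒in-triangle⊎matched (cyc31-wrap _ _ e e₀) = inj₂ (forward (wrap e e₀))
  KEbarEdge⇒in-triangle⊎matched (diam _ _ i<q e)      = inj₂ (across (up i<q e))

  KEbarAdj⇒in-triangle⊎matched : ∀ {u v} → KEbarAdj q u v → proj₁ u ≡ proj₁ v ⊎ Matched q u v
  KEbarAdj⇒in-triangle⊎matched (inj₁ e) = KEbarEdge⇒in-triangle⊎matched e
  KEbarAdj⇒in-triangle⊎matched (inj₂ e) = map⊎ sym matched-sym (KEbarEdge⇒in-triangle⊎matched e)

  first-column-clique : ∀ {i j} → i ≢ j → Adj (KE q) (i , 0F) (j , 0F)
  first-column-clique i≢j = i≢j ∘ cong proj₁ , λ { (inj₁ ()) ; (inj₂ ()) }

  matching : PerfectMatching (Matched q) (Fin q ⊎ Fin (2 * q))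
  matching = record
    { edge      = edge
    ; end₁      = end₁
    ; end₂      = end₂
    ; end₁~end₂ = λ { (inj₁ r) → across (lower-upper-antipodal r) ; (inj₂ i) → forward (next-spec i) }
    ; edge-end₁ = λ { (inj₁ r) → cong inj₁ (residue-lower r) ; (inj₂ i) → refl }
    ; edge-end₂ = λ { (inj₁ r) → cong inj₁ (residue-upper r) ; (inj₂ i) → cong inj₂ (prev-next i) }
    ; end₁⊎end₂ = λ { (i , 0F) → inj₂ (cong (_, 0F) (sym (next-prev i)))
                    ; (i , 1F) → map⊎ (cong (_, 1F)) (cong (_, 1F)) (lower⊎upper i)
                    ; (i , 2F) → inj₁ refl }
    }
    where
    edge : KEVertex q → Fin q ⊎ Fin (2 * q)
    edge (i , 0F) = inj₂ (prev i)
    edge (i , 1F) = inj₁ (residue i)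
    edge (i , 2F) = inj₂ i

    end₁ end₂ : Fin q ⊎ Fin (2 * q) → KEVertex q
    end₁ (inj₁ r) = lower r , 1F
    end₁ (inj₂ i) = i , 2F
    end₂ (inj₁ r) = upper r , 1F
    end₂ (inj₂ i) = next i , 0F

corollary8 : (q : ℕ) → 2 ≤ q →
    2K₂-free (KE q) × ChromaticNumber (KE q) (2 * q) × HasFrozenColouring (KE q) (3 * q)
corollary8 q 2≤q =
    complement-2K₂-free KEbarAdj-sym (induced-C₄-free (matched-unique-between-triangles 2≤q))
  , ((proj₁ , λ u v → block-colouring-proper) , clique⇒¬colourable (λ i → i , 0F) first-column-clique)
  , PerfectMatching.edge colour-matching , matching-frozen colour-matching _≟_
  where
  open CliquesPlusMatching (KEbar q) proj₁ (Matched q) matched-sym matched-functional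
         (matched-between-triangles (≤-trans (s≤s z≤n) 2≤q)) KEbarAdj-in-triangle matched⇒KEbarAdj
         KEbarAdj⇒in-triangle⊎matched

  -- Fin (3 * q) is definitionally Fin (q + 2 * q), the domain of +↔⊎.
  colour-matching : PerfectMatching (Matched q) (Fin (3 * q))
  colour-matching = reindex +↔⊎ matching
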